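{- Let $\mathcal{A} = \langle Q, \Sigma, \rightarrow, Q_0, \varphi\rangle$ be a deterministic complete automaton, and let $T,S\subseteq Q$ with $S$ non-empty, such that $T$ is a minimal trap set of $\mathcal{A}$, $S\cap T\neq\emptyset$, and $T\setminus S$ is neither empty nor a transient of $\mathcal{A}$. Then for every run $\rho$ of $\mathcal{A}$ and every $i\ge0$ with $\rho_i\in T$, the run prefix $\rho_{\le i}$ is an ugly run prefix both for the acceptance condition $\mathrm{Fin}(S)$ and for the acceptance condition $\mathrm{Inf}(S)$.
   Context: An automaton is a tuple $\mathcal{A} = \langle Q, \Sigma, \rightarrow, Q_0, \varphi\rangle$ where $Q$ is a finite set of states, $\Sigma$ a finite alphabet, $\rightarrow \subseteq Q\times\Sigma\times Q$ a labelled transition relation, $Q_0\subseteq Q$ a non-empty set of initial states, and $\varphi$ an acceptance condition. We write $q \xrightarrow{a} q'$ iff $(q,a,q')\in\rightarrow$, and $q\rightarrow q'$ iff $q\xrightarrow{a}q'$ for some $a$. $\mathcal{A}$ is deterministic if $|Q_0|=1$ and for every $(q,a)$ there is at most one $q'$ with $q\xrightarrow{a}q'$; complete if there is at least one. A run for a word $w=w_0w_1\dots\in\Sigma^\omega$ is an infinite sequence $\rho=\rho_0\rho_1\dots$ with $\rho_0\in Q_0$ and $\rho_i\xrightarrow{w_i}\rho_{i+1}$; $w_{\mathcal{A}}(\rho)$ denotes this word. Prefixes: $w_{\le i}=w_0\dots w_i$, $\rho_{\le i}=\rho_0\dots\rho_i$. For non-empty $S\subseteq Q$: $\rho\models\mathrm{Fin}(S)$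 iff there is $i$ with $\rho_j\notin S$ for all $j>i$; $\rho\models\mathrm{Inf}(S)$ iff $\rho\not\models\mathrm{Fin}(S)$. For an acceptance condition $\psi$, the language $L$ of $\mathcal{A}$ with condition $\psi$ is the set of words having a run modelling $\psi$. A finite word $u\in\Sigma^*$ is good (for $\psi$) if $uw\in L$ for all $w\in\Sigma^\omega$, bad if $uw\notin L$ for all $w\in\Sigma^\omega$, and ugly if for all $v\in\Sigma^*$, $uv$ is neither good nor bad. A run prefix $\rho_{\le i}$ is a good/bad/ugly run prefix if $(w_{\mathcal{A}}(\rho))_{\le i}$ is a good/bad/ugly prefix. A non-empty $T\subseteq Q$ is a trap set if $q\in T$ and $q\rightarrow q'$ imply $q'\in T$; minimal if no proper subset is a trap set. A set $S'\subseteq Q$ is a transient of $\mathcal{A}$ if every run of $\mathcal{A}$ models $\mathrm{Inf}(Q\setminus S')$. -}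

module Defs where

open import Data.Nat using (ℕ; zero; suc; _<_)
open import Data.Fin using (Fin)
open import Data.Fin.Subset using (Subset; _∈_; _∉_; _⊂_; ∁; Nonempty)
open import Data.List using (List; []; _∷_; _++_; map; upTo)
open import Data.Product using (Σ; ∃; ∃-syntax; _×_; _,_)
open import Relation.Nullary using (¬_)
open import Relation.Binary.PropositionalEquality using (_≡_)

Word : ℕ → Set
Word m = ℕ → Fin m

StateSeq : ℕ → Set
StateSeq n = ℕ → Fin n

Condition : ℕ → Set₁
Condition n = StateSeq n → Set

record Automaton (n m : ℕ) : Set₁ where
  field
    Δ          : Fin n → Fin m → Fin n → Set
    Q₀         : Subset n
    Q₀-nonempty : Nonempty Q₀
    φ          : Condition n

open Automaton public

Step : ∀ {n m} → Automaton n m → Fin n → Fin n → Set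
Step A q q' = ∃[ a ] Δ A q a q'

Deterministic : ∀ {n m} → Automaton n m → Set
Deterministic A =
  (∀ q q' → q ∈ Q₀ A → q' ∈ Q₀ A → q ≡ q') ×
  (∀ q a q₁ q₂ → Δ A q a q₁ → Δ A q a q₂ → q₁ ≡ q₂)

Complete : ∀ {n m} → Automaton n m → Set
Complete A = ∀ q a → ∃[ q' ] Δ A q a q'

IsRun : ∀ {n m} → Automaton n m → Word m → StateSeq n → Set
IsRun A w ρ = (ρ 0 ∈ Q₀ A) × (∀ i → Δ A (ρ i) (w i) (ρ (suc i)))

FinC : ∀ {n} → Subset n → Condition n
FinC S ρ = ∃[ i ] (∀ j → i < j → ρ j ∉ S)

InfC : ∀ {n} → Subset n → Condition n
InfC S ρ = ¬ FinC S ρ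

Lang : ∀ {n m} → Automaton n m → Condition n → Word m → Set
Lang A ψ w = ∃[ ρ ] (IsRun A w ρ × ψ ρ)

_++ω_ : ∀ {m} → List (Fin m) → Word m → Word m
([] ++ω w) i = w i
((a ∷ u) ++ω w) zero = a
((a ∷ u) ++ω w) (suc i) = (u ++ω w) i

Good : ∀ {n m} → Automaton n m → Condition n → List (Fin m) → Set
Good A ψ u = ∀ (w : Word _) → Lang A ψ (u ++ω w)

Bad : ∀ {n m} → Automaton n m → Condition n → List (Fin m) → Set
Bad A ψ u = ∀ (w : Word _) → ¬ Lang A ψ (u ++ω w)

Ugly : ∀ {n m} → Automaton n m → Condition n → List (Fin m) → Set
Ugly A ψ u = ∀ (v : List (Fin _)) → ¬ Good A ψ (u ++ v) × ¬ Bad A ψ (u ++ v)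

prefix : ∀ {m} → Word m → ℕ → List (Fin m)
prefix w i = map w (upTo (suc i))

-- ρ_{≤i} (for the run ρ of the word w) is an ugly run prefix for ψ
UglyRunPrefix : ∀ {n m} → Automaton n m → Condition n → Word m → StateSeq n → ℕ → Set
UglyRunPrefix A ψ w ρ i = Ugly A ψ (prefix w i)

TrapSet : ∀ {n m} → Automaton n m → Subset n → Set
TrapSet A T = Nonempty T × (∀ q q' → q ∈ T → Step A q q' → q' ∈ T)

MinimalTrapSet : ∀ {n m} → Automaton n m → Subset n → Set
MinimalTrapSet A T = TrapSet A T × (∀ T' → T' ⊂ T → ¬ TrapSet A T')

Transient : ∀ {n m} → Automaton n m → Subset n → Set
Transient A S' = ∀ w ρ → IsRun A w ρ → InfC (∁ S') ρ

-- Determinism makes the run on u ++ω y, from position |u| on, the run of y from the state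
-- reached by u. After any extension of ρ_{≤i} that state lies in the minimal trap set T,
-- which is strongly connected; so it can be steered to a state s ∈ S ∩ T and around a cycle
-- through s forever (Inf(S) holds, Fin(S) fails), or into the tail of a run that stays in
-- T ∖ S, which exists because T ∖ S is not transient (Fin(S) holds, Inf(S) fails). Hence no
-- extension is good or bad for either condition. The argument is classical only in choosing
-- continuations, which is harmless as all four goals are negations.
module Submission where

open import Defs
open import Data.Nat using (ℕ)
open import Data.Fin.Subset using (Subset; _∈_; _∩_; _─_; Nonempty)
open import Data.Product using (_×_)
open import Relation.Nullary using (¬_)

open import Data.Empty using (⊥)
open import Data.Fin using (Fin; zero; suc)
open import Data.Fin.Subset using (_∉_; _⊆_; ∁; inside; outside)
open import Data.Fin.Subset.Properties using (x∉∁p⇒x∈p; x∉p⇒x∈∁p; x∈p∩q⁻; p─q⊆p)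
open import Data.List using (List; []; _∷_; _++_; [_]; length; applyUpTo)
open import Data.List.Properties using (map-applyUpTo)
open import Data.Nat using (zero; suc; _+_; _*_; _<_)
open import Data.Nat.Properties
  using (≤-refl; <⇒≤; m≤n⇒m≤o+n; m+n≤o⇒m≤o; +-cancelˡ-<; m≤m*n; m≤n⇒∃[o]m+o≡n)
open import Data.Product using (∃-syntax; _,_; proj₁; proj₂; map₂)
open import Data.Vec using (_∷_; here; there; tabulate)
open import Data.Vec.Properties using (lookup∘tabulate; lookup⇒[]=; []=⇒lookup)
open import Function using (_∘_)
open import Function.Bundles using (_⇔_; mk⇔; Equivalence)
open import Relation.Nullary using (Dec; does; yes; no)
open import Relation.Nullary.Decidable using (dec-true; ¬¬-excluded-middle)
open import Relation.Nullary.Negation using (¬¬-map)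
open import Relation.Binary.PropositionalEquality
  using (_≡_; refl; sym; trans; cong; subst; _≗_; module ≡-Reasoning)

open Equivalence using (to; from)

¬¬-∀-Fin : ∀ {n} {P : Fin n → Set} → (∀ i → ¬ ¬ P i) → ¬ ¬ (∀ i → P i)
¬¬-∀-Fin {zero}  _   k = k λ ()
¬¬-∀-Fin {suc n} ¬¬P k =
  ¬¬P zero λ p₀ → ¬¬-∀-Fin (λ i → ¬¬P (suc i)) λ p → k λ { zero → p₀ ; (suc i) → p i }

x∈p─q⇒x∉q : ∀ {n} (p q : Subset n) {x : Fin n} → x ∈ p ─ q → x ∉ q
x∈p─q⇒x∉q (_ ∷ p) (outside ∷ q) here      ()
x∈p─q⇒x∉q (_ ∷ p) (inside  ∷ q) {zero} () _
x∈p─q⇒x∉q (_ ∷ p) (_       ∷ q) (there x∈p─q) (there x∈q) = x∈p─q⇒x∉q p q x∈p─q x∈q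

module _ {n} {P : Fin n → Set} (P? : ∀ x → Dec (P x)) where

  subsetOf : Subset n
  subsetOf = tabulate (does ∘ P?)

  ∈-subsetOf⁺ : ∀ {x} → P x → x ∈ subsetOf
  ∈-subsetOf⁺ {x} px = lookup⇒[]= x _ (trans (lookup∘tabulate _ x) (dec-true (P? x) px))

  ∈-subsetOf⁻ : ∀ {x} → x ∈ subsetOf → P x
  ∈-subsetOf⁻ {x} x∈ with P? x | trans (sym (lookup∘tabulate _ x)) ([]=⇒lookup x∈)
  ... | yes px | _  = px
  ... | no _   | ()

module _ {n} {S : Subset n} where

  FinC-cong : ∀ {σ σ′} → σ ≗ σ′ → FinC S σ → FinC S σ′
  FinC-cong σ≗σ′ (i , f) = i , λ j i<j → f j i<j ∘ subst (_∈ S) (sym (σ≗σ′ j))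

  FinC-shift : ∀ k {σ} → FinC S σ → FinC S (σ ∘ (k +_))
  FinC-shift k (i , f) = i , λ j i<j → f (k + j) (m≤n⇒m≤o+n k i<j)

  FinC-unshift : ∀ k {σ} → FinC S (σ ∘ (k +_)) → FinC S σ
  FinC-unshift k {σ} (i , f) = k + i , avoid
    where
    avoid : ∀ j → k + i < j → σ j ∉ S
    avoid j k+i<j with m≤n⇒∃[o]m+o≡n (m+n≤o⇒m≤o k (<⇒≤ k+i<j))
    ... | d , refl = f d (+-cancelˡ-< k i d k+i<j)

FinC-anti : ∀ {n} {S S′ : Subset n} {σ} → S ⊆ S′ → FinC S′ σ → FinC S σ
FinC-anti S⊆S′ (i , f) = i , λ j i<j → f j i<j ∘ S⊆S′

module DeterministicRuns {n m} (δ : Fin n → Fin m → Fin n) where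

  run : Fin n → Word m → StateSeq n
  run q x zero    = q
  run q x (suc j) = run (δ q (x 0)) (x ∘ suc) j

  δ* : Fin n → List (Fin m) → Fin n
  δ* q []      = q
  δ* q (a ∷ u) = δ* (δ q a) u

  run-suc : ∀ q x j → run q x (suc j) ≡ δ (run q x j) (x j)
  run-suc q x zero    = refl
  run-suc q x (suc j) = run-suc (δ q (x 0)) (x ∘ suc) j

  run-+ : ∀ q x k j → run q x (k + j) ≡ run (run q x k) (x ∘ (k +_)) j
  run-+ q x zero    j = refl
  run-+ q x (suc k) j = run-+ (δ q (x 0)) (x ∘ suc) k j

  δ*-++ : ∀ q u v → δ* q (u ++ v) ≡ δ* (δ* q u) v
  δ*-++ q []      v = refl
  δ*-++ q (a ∷ u) v = δ*-++ (δ q a) u v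

  run-++ω : ∀ q u x j → run q (u ++ω x) (length u + j) ≡ run (δ* q u) x j
  run-++ω q []      x j = refl
  run-++ω q (a ∷ u) x j = run-++ω (δ q a) u x j

  δ*-applyUpTo : ∀ q x k → δ* q (applyUpTo x k) ≡ run q x k
  δ*-applyUpTo q x zero    = refl
  δ*-applyUpTo q x (suc k) = δ*-applyUpTo (δ q (x 0)) (x ∘ suc) k

  δ*-prefix : ∀ q x i → δ* q (prefix x i) ≡ run q x (suc i)
  δ*-prefix q x i =
    trans (cong (δ* q) (map-applyUpTo (λ t → t) x (suc i))) (δ*-applyUpTo q x (suc i))

  module _ {S : Subset n} (q : Fin n) (u : List (Fin m)) (x : Word m) where

    FinC-run-++ω⁺ : FinC S (run (δ* q u) x) → FinC S (run q (u ++ω x))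
    FinC-run-++ω⁺ = FinC-unshift (length u) ∘ FinC-cong (sym ∘ run-++ω q u x)

    FinC-run-++ω⁻ : FinC S (run q (u ++ω x)) → FinC S (run (δ* q u) x)
    FinC-run-++ω⁻ = FinC-cong (run-++ω q u x) ∘ FinC-shift (length u)

    InfC-run-++ω⁺ : InfC S (run (δ* q u) x) → InfC S (run q (u ++ω x))
    InfC-run-++ω⁺ inf = inf ∘ FinC-run-++ω⁻

    InfC-run-++ω⁻ : InfC S (run q (u ++ω x)) → InfC S (run (δ* q u) x)
    InfC-run-++ω⁻ inf = inf ∘ FinC-run-++ω⁺

  module _ (a : Fin m) (l : List (Fin m)) where

    private
      after : List (Fin m) → Word m
      after []      zero    = a
      after []      (suc j) = after l j
      after (b ∷ r) zero    = b
      after (b ∷ r) (suc j) = after r j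

      run-after : ∀ q r j → run q (after r) (length r + j) ≡ run (δ* q r) (after []) j
      run-after q []      j = refl
      run-after q (b ∷ r) j = run-after (δ q b) r j

    cycleω : Word m
    cycleω = after []

    run-cycleω : ∀ q j → run q cycleω (suc (length l) + j) ≡ run (δ* q (a ∷ l)) cycleω j
    run-cycleω q = run-after (δ q a) l

    InfC-cycleω : ∀ {S q} → δ* q (a ∷ l) ≡ q → q ∈ S → InfC S (run q cycleω)
    InfC-cycleω {S} {q} loop q∈S (i , f) =
      f (suc i * period) (m≤m*n (suc i) period) (subst (_∈ S) (sym (returns (suc i))) q∈S)
      where
      period : ℕ
      period = suc (length l)

      returns : ∀ N → run q cycleω (N * period) ≡ q
      returns zero    = refl
      returns (suc N) = begin
        run q cycleω (period + N * period)       ≡⟨ run-cycleω q (N * period) ⟩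
        run (δ* q (a ∷ l)) cycleω (N * period)   ≡⟨ cong (λ p → run p cycleω (N * period)) loop ⟩
        run q cycleω (N * period)                ≡⟨ returns N ⟩
        q                                        ∎
        where open ≡-Reasoning

module DeterministicAutomaton
  {n m} (A : Automaton n m) (det : Deterministic A) (complete : Complete A) where

  δ : Fin n → Fin m → Fin n
  δ q a = proj₁ (complete q a)

  open DeterministicRuns δ public

  q₀ : Fin n
  q₀ = proj₁ (Q₀-nonempty A)

  step-δ : ∀ {q a q′} → Δ A q a q′ → q′ ≡ δ q a
  step-δ {q} {a} t = proj₂ det q a _ _ t (proj₂ (complete q a))

  run-isRun : ∀ x → IsRun A x (run q₀ x)
  run-isRun x = proj₂ (Q₀-nonempty A) ,
    λ j → subst (Δ A (run q₀ x j) (x j)) (sym (run-suc q₀ x j)) (proj₂ (complete _ _))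

  run-unique : ∀ {x σ} → IsRun A x σ → σ ≗ run q₀ x
  run-unique (σ₀∈Q₀ , _) zero = proj₁ det _ _ σ₀∈Q₀ (proj₂ (Q₀-nonempty A))
  run-unique {x} {σ} r@(_ , steps) (suc j) = begin
    σ (suc j)               ≡⟨ step-δ (steps j) ⟩
    δ (σ j) (x j)           ≡⟨ cong (λ p → δ p (x j)) (run-unique r j) ⟩
    δ (run q₀ x j) (x j)    ≡⟨ run-suc q₀ x j ⟨
    run q₀ x (suc j)        ∎
    where open ≡-Reasoning

  run-suffix : ∀ {x σ} → IsRun A x σ → ∀ k → σ ∘ (k +_) ≗ run (σ k) (x ∘ (k +_))
  run-suffix {x} {σ} r k j = begin
    σ (k + j)                          ≡⟨ run-unique r (k + j) ⟩
    run q₀ x (k + j)                   ≡⟨ run-+ q₀ x k j ⟩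
    run (run q₀ x k) (x ∘ (k +_)) j    ≡⟨ cong (λ p → run p (x ∘ (k +_)) j) (run-unique r k) ⟨
    run (σ k) (x ∘ (k +_)) j           ∎
    where open ≡-Reasoning

  δ*-prefix-run : ∀ {x σ} → IsRun A x σ → ∀ i → δ* q₀ (prefix x i) ≡ σ (suc i)
  δ*-prefix-run {x} r i = trans (δ*-prefix q₀ x i) (sym (run-unique r (suc i)))

  module _ {S : Subset n} (u : List (Fin m)) (y : Word m) where

    Lang-FinC-++ω : Lang A (FinC S) (u ++ω y) ⇔ FinC S (run (δ* q₀ u) y)
    Lang-FinC-++ω = mk⇔
      (λ (σ , r , fin) → FinC-run-++ω⁻ q₀ u y (FinC-cong (run-unique r) fin))
      (λ fin → run q₀ (u ++ω y) , run-isRun (u ++ω y) , FinC-run-++ω⁺ q₀ u y fin)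

    Lang-InfC-++ω : Lang A (InfC S) (u ++ω y) ⇔ InfC S (run (δ* q₀ u) y)
    Lang-InfC-++ω = mk⇔
      (λ (σ , r , inf) → InfC-run-++ω⁻ q₀ u y (inf ∘ FinC-cong (sym ∘ run-unique r)))
      (λ inf → run q₀ (u ++ω y) , run-isRun (u ++ω y) , InfC-run-++ω⁺ q₀ u y inf)

  neither-good-nor-bad : ∀ {ψ u} → (∀ y → Lang A ψ (u ++ω y) ⇔ ψ (run (δ* q₀ u) y)) →
    ¬ ¬ (∃[ y ] ψ (run (δ* q₀ u) y)) → ¬ ¬ (∃[ y ] ¬ ψ (run (δ* q₀ u) y)) →
    ¬ Good A ψ u × ¬ Bad A ψ u
  neither-good-nor-bad lang sat unsat =
    (λ good → unsat λ (y , ¬ψ) → ¬ψ (to (lang y) (good y))) ,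
    (λ bad → sat λ (y , ψ) → bad y (from (lang y) ψ))

  δ*-trap : ∀ {T} → TrapSet A T → ∀ {q} u → q ∈ T → δ* q u ∈ T
  δ*-trap trap []      q∈T = q∈T
  δ*-trap trap {q} (a ∷ u) q∈T =
    δ*-trap trap u (proj₂ trap q (δ q a) q∈T (a , proj₂ (complete q a)))

  Reachable : Fin n → Fin n → Set
  Reachable q t = ∃[ u ] δ* q u ≡ t

  -- The states reachable from q form a trap set inside T, so by minimality they exhaust T.
  minimalTrap⇒reachable : ∀ {T} → MinimalTrapSet A T →
    ∀ {q t} → q ∈ T → t ∈ T → ¬ ¬ Reachable q t
  minimalTrap⇒reachable {T} (trap , minimal) {q} {t} q∈T t∈T ¬q⇝t =
    ¬¬-∀-Fin (λ _ → ¬¬-excluded-middle) reachableSet-refutes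
    where
    reachableSet-refutes : (∀ p → Dec (Reachable q p)) → ⊥
    reachableSet-refutes q⇝? =
      minimal R (R⊆T , t , t∈T , ¬q⇝t ∘ ∈-subsetOf⁻ q⇝?) (R-nonempty , R-closed)
      where
      R : Subset n
      R = subsetOf q⇝?

      R⊆T : R ⊆ T
      R⊆T p∈R with ∈-subsetOf⁻ q⇝? p∈R
      ... | u , refl = δ*-trap trap u q∈T

      R-nonempty : Nonempty R
      R-nonempty = q , ∈-subsetOf⁺ q⇝? ([] , refl)

      R-closed : ∀ p p′ → p ∈ R → Step A p p′ → p′ ∈ R
      R-closed p p′ p∈R (a , p→p′) with ∈-subsetOf⁻ q⇝? p∈R
      ... | u , refl =
        ∈-subsetOf⁺ q⇝? (u ++ [ a ] , trans (δ*-++ q u [ a ]) (sym (step-δ p→p′)))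

  ¬transient⇒avoiding-tail : ∀ {T S} → ¬ Transient A (T ─ S) →
    ¬ ¬ (∃[ t ] t ∈ T × ∃[ y ] FinC S (run t y))
  ¬transient⇒avoiding-tail {T} {S} notTransient k = notTransient λ x σ r (i , stays) →
    k ( σ (suc i)
      , p─q⊆p T S (x∉∁p⇒x∈p (stays (suc i) ≤-refl))
      , x ∘ (suc i +_)
      , FinC-cong (run-suffix r (suc i)) (FinC-shift (suc i) (FinC-anti S⊆∁[T─S] (i , stays))))
    where
    S⊆∁[T─S] : S ⊆ ∁ (T ─ S)
    S⊆∁[T─S] x∈S = x∉p⇒x∈∁p λ x∈T─S → x∈p─q⇒x∉q T S x∈T─S x∈S

  module _ {T : Subset n} (minimal : MinimalTrapSet A T) where

    private
      reach : ∀ {q t} → q ∈ T → t ∈ T → ¬ ¬ Reachable q t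
      reach = minimalTrap⇒reachable minimal

    steer : ∀ {ψ : Condition n} → (∀ q u y → ψ (run (δ* q u) y) → ψ (run q (u ++ω y))) →
      ∀ {q t} → q ∈ T → t ∈ T → ∃[ y ] ψ (run t y) → ¬ ¬ (∃[ y ] ψ (run q y))
    steer {ψ} prepend {q} q∈T t∈T (y , ψ-from-t) k = reach q∈T t∈T λ (p , q⇝t) →
      k (p ++ω y , prepend q p y (subst (λ t → ψ (run t y)) (sym q⇝t) ψ-from-t))

    recurrent-continuation : ∀ {S s} → s ∈ S → s ∈ T → Fin m →
      ∀ {q} → q ∈ T → ¬ ¬ (∃[ y ] InfC S (run q y))
    recurrent-continuation {S} s∈S s∈T a q∈T k =
      reach (δ*-trap (proj₁ minimal) [ a ] s∈T) s∈T λ (l , back) →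
      steer {InfC S} InfC-run-++ω⁺ q∈T s∈T (cycleω a l , InfC-cycleω a l back s∈S) k

    avoiding-continuation : ∀ {S} → ¬ Transient A (T ─ S) →
      ∀ {q} → q ∈ T → ¬ ¬ (∃[ y ] FinC S (run q y))
    avoiding-continuation {S} notTransient q∈T k =
      ¬transient⇒avoiding-tail notTransient λ (t , t∈T , tail) →
      steer {FinC S} FinC-run-++ω⁺ q∈T t∈T tail k

theorem3 : ∀ {n m} (A : Automaton n m) → Deterministic A → Complete A →
    (T S : Subset n) → Nonempty S → MinimalTrapSet A T →
    Nonempty (S ∩ T) → Nonempty (T ─ S) → ¬ Transient A (T ─ S) →
    ∀ (w : Word m) (ρ : StateSeq n) → IsRun A w ρ →
    ∀ (i : ℕ) → ρ i ∈ T →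
    UglyRunPrefix A (FinC S) w ρ i × UglyRunPrefix A (InfC S) w ρ i
theorem3 A det complete T S _ minimal (s , s∈S∩T) _ notTransient w ρ isRun i ρi∈T =
    (λ v → neither-good-nor-bad {FinC S} {u v} (Lang-FinC-++ω (u v)) (avoiding v) (recurrent v))
  , (λ v → neither-good-nor-bad {InfC S} {u v} (Lang-InfC-++ω (u v)) (recurrent v)
             (¬¬-map (map₂ λ fin inf → inf fin) (avoiding v)))
  where
  open DeterministicAutomaton A det complete

  u : List _ → List _
  u v = prefix w i ++ v

  u∈T : ∀ v → δ* q₀ (u v) ∈ T
  u∈T v = subst (_∈ T) (sym (δ*-++ q₀ (prefix w i) v))
    (δ*-trap (proj₁ minimal) v
      (subst (_∈ T) (sym (δ*-prefix-run isRun i))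
        (proj₂ (proj₁ minimal) (ρ i) (ρ (suc i)) ρi∈T (w i , proj₂ isRun i))))

  s∈S : s ∈ S
  s∈S = proj₁ (x∈p∩q⁻ S T s∈S∩T)

  s∈T : s ∈ T
  s∈T = proj₂ (x∈p∩q⁻ S T s∈S∩T)

  recurrent : ∀ v → ¬ ¬ (∃[ y ] InfC S (run (δ* q₀ (u v)) y))
  recurrent v = recurrent-continuation minimal s∈S s∈T (w 0) (u∈T v)

  avoiding : ∀ v → ¬ ¬ (∃[ y ] FinC S (run (δ* q₀ (u v)) y))
  avoiding v = avoiding-continuation minimal notTransient (u∈T v)
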